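{- In the setting described in the context, each connected component $A\in\mathcal{A}$ contains exactly one vertex from $I$ and no other vertex from $N_G(v)$.
   Context: Let $G$ be a finite simple undirected graph; a chordless cycle is an induced cycle on at least four vertices, and a graph is chordal if it has none. Let $E_I,E_M\subseteq E(G)$ and for $u\in V(G)$ let $N^R_G(u)=\{w\in N_G(u):\{u,w\}\notin E_I\cup E_M\}$. Fix $v\in V(G)$ and a set $B_v\subseteq V(G)\setminus\{v\}$ such that $G\setminus B_v$ is chordal. Let $I$ be an independent set of $G$ with $I\subseteq N^R_G(v)\setminus B_v$. Let $X=N_G(v)\setminus(B_v\cup I)$, let $H=G\setminus(\{v\}\cup B_v\cup X)$, and let $\mathcal{A}$ be the set of connected components of $H$ that contain at least one vertex of $I$. -}

module Defs where

open import Data.Nat using (ℕ; suc; _%_)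
open import Data.Fin using (Fin; toℕ)
open import Data.Fin.Subset using (Subset; _∈_; _∉_)
open import Data.Bool using (Bool; true; false)
open import Data.Product using (Σ; _×_; ∃)
open import Data.Sum using (_⊎_)
open import Relation.Binary.PropositionalEquality using (_≡_)
open import Relation.Nullary using (¬_)
open import Function.Definitions using (Injective)
open import Relation.Binary.Construct.Closure.ReflexiveTransitive using (Star)

record Graph (n : ℕ) : Set where
  field
    adj     : Fin n → Fin n → Bool
    adj-sym : ∀ u w → adj u w ≡ adj w u
    adj-irr : ∀ u → adj u u ≡ false

open Graph public

Adj : ∀ {n} → Graph n → Fin n → Fin n → Set
Adj G u w = adj G u w ≡ true

-- An edge set of G, given as a Boolean predicate on (ordered) vertex pairs;
-- the unordered edge {u,w} is in the set iff the predicate holds for (u,w) or (w,u).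
EdgeSet : ℕ → Set
EdgeSet n = Fin n → Fin n → Bool

InEdges : ∀ {n} → EdgeSet n → Fin n → Fin n → Set
InEdges F u w = (F u w ≡ true) ⊎ (F w u ≡ true)

EdgeSubset : ∀ {n} → Graph n → EdgeSet n → Set
EdgeSubset G F = ∀ u w → InEdges F u w → Adj G u w

N : ∀ {n} → Graph n → Fin n → Fin n → Set
N G u w = Adj G u w

NR : ∀ {n} → Graph n → EdgeSet n → EdgeSet n → Fin n → Fin n → Set
NR G EI EM u w = Adj G u w × ¬ (InEdges EI u w ⊎ InEdges EM u w)

Consec : ∀ {m} → Fin (suc m) → Fin (suc m) → Set
Consec {m} i j = (suc (toℕ i) % suc m ≡ toℕ j) ⊎ (suc (toℕ j) % suc m ≡ toℕ i)

-- A chordless cycle of G avoiding the vertex set S (i.e. a chordless cycle of G \ S):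
-- k = 4 + m distinct vertices c 0, …, c (k-1), with c i adjacent to c j
-- exactly when i and j are cyclically consecutive.
record ChordlessCycleAvoiding {n} (G : Graph n) (S : Subset n) : Set where
  field
    m       : ℕ
    c       : Fin (suc (suc (suc (suc m)))) → Fin n
    c-inj   : Injective _≡_ _≡_ c
    c-avoid : ∀ i → c i ∉ S
    c-adj   : ∀ i j → Consec i j → Adj G (c i) (c j)
    c-nonadj : ∀ i j → ¬ Consec i j → ¬ Adj G (c i) (c j)

ChordalMinus : ∀ {n} → Graph n → Subset n → Set
ChordalMinus G S = ¬ ChordlessCycleAvoiding G S

Independent : ∀ {n} → Graph n → Subset n → Set
Independent G I = ∀ u w → u ∈ I → w ∈ I → ¬ Adj G u w

X : ∀ {n} → Graph n → Fin n → Subset n → Subset n → Fin n → Set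
X G v B I u = N G v u × u ∉ B × u ∉ I

InH : ∀ {n} → Graph n → Fin n → Subset n → Subset n → Fin n → Set
InH G v B I u = ¬ (u ≡ v) × u ∉ B × ¬ X G v B I u

EdgeH : ∀ {n} → Graph n → Fin n → Subset n → Subset n → Fin n → Fin n → Set
EdgeH G v B I u w = InH G v B I u × InH G v B I w × Adj G u w

-- u and w lie in the same connected component of H (u assumed to be a vertex of H)
ReachH : ∀ {n} → Graph n → Fin n → Subset n → Subset n → Fin n → Fin n → Set
ReachH G v B I = Star (EdgeH G v B I)

-- A walk in H between two distinct neighbours of v can be shortened until it is an
-- induced path whose only vertices adjacent to v are its two ends: cutting out a
-- repeated stretch, jumping along a chord, or splitting at an inner neighbour of v.
-- Such a path has length 1 or at least 2.  Length 1 joins two vertices of I, which is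
-- independent (every neighbour of v in H lies in I, since X was removed).  Length at
-- least 2 closes up through v to a chordless cycle avoiding B, contradicting the
-- chordality of G \ B.
module Submission where

open import Defs
open import Data.Nat using (ℕ; zero; suc; _+_; _∸_; _≤_; _<_; z≤n; s≤s; _%_; _<?_)
open import Data.Nat.Properties
open import Data.Nat.DivMod using (n%n≡0; m<n⇒m%n≡m)
open import Data.Nat.Induction using (<-rec)
open import Data.Fin using (Fin; toℕ) renaming (_≟_ to _≟ᶠ_)
open import Data.Fin.Properties using (toℕ-injective; toℕ≤pred[n])
open import Data.Fin.Subset using (Subset; _∈_; _∉_)
open import Data.Fin.Subset.Properties using (_∈?_)
open import Data.Bool using (true)
import Data.Bool as Bool
open import Data.Product using (∃; _×_; _,_; proj₁; proj₂)
open import Data.Sum using (_⊎_; inj₁; inj₂; swap; [_,_]′)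
import Data.Sum as Sum
open import Data.Empty using (⊥-elim)
open import Relation.Nullary using (¬_; Dec; yes; no)
open import Relation.Nullary.Decidable using (_×-dec_)
open import Relation.Binary.PropositionalEquality using (_≡_; _≢_; refl; sym; trans; cong; subst; subst₂)
open import Relation.Binary.Definitions using (tri<; tri≈; tri>)
open import Relation.Binary.Construct.Closure.ReflexiveTransitive using (Star; ε; _◅_; _◅◅_; reverse)

data CyclicSucc (K : ℕ) : ℕ → ℕ → Set where
  next : ∀ {a} → a < K → CyclicSucc K a (suc a)
  wrap : CyclicSucc K K 0

%-cyclicSucc : ∀ {K a b} → a ≤ K → suc a % suc K ≡ b → CyclicSucc K a b
%-cyclicSucc {K} a≤K e with m≤n⇒m<n∨m≡n a≤K
... | inj₁ a<K = subst (CyclicSucc K _) (trans (sym (m<n⇒m%n≡m (s≤s a<K))) e) (next a<K)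
... | inj₂ refl = subst (CyclicSucc K K) (trans (sym (n%n≡0 (suc K))) e) wrap

cyclicSucc-% : ∀ {K a b} → CyclicSucc K a b → suc a % suc K ≡ b
cyclicSucc-% (next a<K) = m<n⇒m%n≡m (s≤s a<K)
cyclicSucc-% {K} wrap = n%n≡0 (suc K)

Consec⇒cyclicSucc : ∀ {K} (i j : Fin (suc K)) → Consec i j →
  CyclicSucc K (toℕ i) (toℕ j) ⊎ CyclicSucc K (toℕ j) (toℕ i)
Consec⇒cyclicSucc i j = Sum.map (%-cyclicSucc (toℕ≤pred[n] i)) (%-cyclicSucc (toℕ≤pred[n] j))

cyclicSucc⇒Consec : ∀ {K} (i j : Fin (suc K)) →
  CyclicSucc K (toℕ i) (toℕ j) ⊎ CyclicSucc K (toℕ j) (toℕ i) → Consec i j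
cyclicSucc⇒Consec i j = Sum.map cyclicSucc-% cyclicSucc-%

m<n≤o⇒m+[o∸n]<o : ∀ {m n o} → m < n → n ≤ o → m + (o ∸ n) < o
m<n≤o⇒m+[o∸n]<o {m} {n} {o} m<n n≤o =
  subst (m + (o ∸ n) <_) (m+[n∸m]≡n n≤o) (+-monoˡ-< (o ∸ n) m<n)

module _ {n} (G : Graph n) where

  Adj-sym : ∀ {x y} → Adj G x y → Adj G y x
  Adj-sym {x} {y} e = trans (adj-sym G y x) e

  Adj-irrefl : ∀ {x} → ¬ Adj G x x
  Adj-irrefl {x} e with trans (sym (adj-irr G x)) e
  ... | ()

  Adj? : ∀ x y → Dec (Adj G x y)
  Adj? x y = adj G x y Bool.≟ true

  module Walks (P : Fin n → Set) where

    InducedEdge : Fin n → Fin n → Set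
    InducedEdge x y = P x × P y × Adj G x y

    record Walk (x y : Fin n) (L : ℕ) : Set where
      field
        at     : ℕ → Fin n
        at-0   : at 0 ≡ x
        at-len : at L ≡ y
        inside : ∀ {k} → k ≤ L → P (at k)
        step   : ∀ {k} → k < L → Adj G (at k) (at (suc k))

    open Walk public

    [_] : ∀ {x} → P x → Walk x x 0
    [_] {x} px = record
      { at = λ _ → x ; at-0 = refl ; at-len = refl ; inside = λ _ → px ; step = λ () }

    cons : ∀ {x z y L} → P x → Adj G x z → Walk z y L → Walk x y (suc L)
    cons {x} px xz q = record
      { at     = λ { zero → x ; (suc k) → at q k }
      ; at-0   = refl
      ; at-len = at-len q
      ; inside = λ { {zero} _ → px ; {suc k} (s≤s k≤L) → inside q k≤L }
      ; step   = λ { {zero} _ → subst (Adj G x) (sym (at-0 q)) xz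
                   ; {suc k} (s≤s k<L) → step q k<L }
      }

    take : ∀ {x y L} (p : Walk x y L) k → k ≤ L → Walk x (at p k) k
    take p k k≤L = record
      { at = at p ; at-0 = at-0 p ; at-len = refl
      ; inside = λ j≤k → inside p (≤-trans j≤k k≤L)
      ; step = λ j<k → step p (<-≤-trans j<k k≤L)
      }

    drop : ∀ {x y L} (p : Walk x y L) k → k ≤ L → Walk (at p k) y (L ∸ k)
    drop {L = L} p k k≤L = record
      { at     = λ u → at p (u + k)
      ; at-0   = refl
      ; at-len = trans (cong (at p) (m∸n+n≡m k≤L)) (at-len p)
      ; inside = λ u≤ → inside p (subst (_ ≤_) (m∸n+n≡m k≤L) (+-monoˡ-≤ k u≤))
      ; step   = λ u< → step p (subst (_ <_) (m∸n+n≡m k≤L) (+-monoˡ-< k u<))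
      }

    _++_ : ∀ {x z y L₁ L₂} → Walk x z L₁ → Walk z y L₂ → Walk x y (L₁ + L₂)
    _++_ {L₁ = zero} p q = subst (λ w → Walk w _ _) (trans (sym (at-len p)) (at-0 p)) q
    _++_ {L₁ = suc L₁} p q =
      cons (subst P (at-0 p) (inside p z≤n)) (subst (λ w → Adj G w (at p 1)) (at-0 p) (step p (s≤s z≤n)))
           (_++_ {L₁ = L₁} (drop p 1 (s≤s z≤n)) q)

    walk-of-star : ∀ {x y} → P x → Star InducedEdge x y → ∃ (Walk x y)
    walk-of-star px ε = 0 , [ px ]
    walk-of-star px ((_ , pz , xz) ◅ rest) with walk-of-star pz rest
    ... | L , q = suc L , cons px xz q

    Repetition : ∀ {x y L} → Walk x y L → Set
    Repetition {L = L} p = ∃ λ t → t < suc L × ∃ λ s → s < t × at p s ≡ at p t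

    Chord : ∀ {x y L} → Walk x y L → Set
    Chord {L = L} p = ∃ λ t → t < L × ∃ λ s → s < t × Adj G (at p s) (at p (suc t))

    InnerNeighbour : ∀ {x y L} → Fin n → Walk x y L → Set
    InnerNeighbour {L = L} v p = ∃ λ k → k < L × 0 < k × Adj G v (at p k)

    repetition? : ∀ {x y L} (p : Walk x y L) → Dec (Repetition p)
    repetition? {L = L} p =
      anyUpTo? (λ t → anyUpTo? (λ s → at p s ≟ᶠ at p t) t) (suc L)

    chord? : ∀ {x y L} (p : Walk x y L) → Dec (Chord p)
    chord? {L = L} p =
      anyUpTo? (λ t → anyUpTo? (λ s → Adj? (at p s) (at p (suc t))) t) L

    innerNeighbour? : ∀ {x y L} v (p : Walk x y L) → Dec (InnerNeighbour v p)
    innerNeighbour? {L = L} v p = anyUpTo? (λ k → (0 <? k) ×-dec Adj? v (at p k)) L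

    ShorterWalk : Fin n → Fin n → ℕ → Set
    ShorterWalk x y L = ∃ λ L′ → L′ < L × Walk x y L′

    shortcut-repetition : ∀ {x y L} (p : Walk x y L) → Repetition p → ShorterWalk x y L
    shortcut-repetition {y = y} p (t , s≤s t≤L , s , s<t , eq) =
      s + (_ ∸ t) , m<n≤o⇒m+[o∸n]<o s<t t≤L ,
      take p s (≤-trans (<⇒≤ s<t) t≤L) ++ subst (λ w → Walk w y _) (sym eq) (drop p t t≤L)

    shortcut-chord : ∀ {x y L} (p : Walk x y L) → Chord p → ShorterWalk x y L
    shortcut-chord {L = L} p (t , t<L , s , s<t , e) =
      s + suc (L ∸ suc t) ,
      subst (_< L) (sym (+-suc s _)) (m<n≤o⇒m+[o∸n]<o (s≤s s<t) t<L) ,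
      take p s (≤-trans (<⇒≤ s<t) (<⇒≤ t<L))
        ++ cons (inside p (≤-trans (<⇒≤ s<t) (<⇒≤ t<L))) e (drop p (suc t) t<L)

    module _ (v : Fin n) (B : Subset n) (v∉B : v ∉ B)
             (P⇒≢v : ∀ {u} → P u → u ≢ v) (P⇒∉B : ∀ {u} → P u → u ∉ B) where

      chordless-cycle : ∀ {x y m} (p : Walk x y (suc (suc m))) → Adj G v x → Adj G v y →
        ¬ Repetition p → ¬ Chord p → ¬ InnerNeighbour v p → ChordlessCycleAvoiding G B
      chordless-cycle {x} {y} {m} p vx vy no-repetition no-chord no-inner = record
        { m        = m
        ; c        = λ i → h (toℕ i)
        ; c-inj    = λ {i} {j} e → toℕ-injective (h-injective (toℕ≤pred[n] i) (toℕ≤pred[n] j) e)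
        ; c-avoid  = λ i → h-∉B (toℕ≤pred[n] i)
        ; c-adj    = λ i j c → [ h-adj , (λ c → Adj-sym (h-adj c)) ]′ (Consec⇒cyclicSucc i j c)
        ; c-nonadj = λ i j nc e →
            nc (cyclicSucc⇒Consec i j (h-adj⇒cyclicSucc (toℕ≤pred[n] i) (toℕ≤pred[n] j) e))
        }
        where
        L K : ℕ
        L = suc (suc m)
        K = suc L

        h : ℕ → Fin n
        h zero    = v
        h (suc k) = at p k

        h-injective : ∀ {a b} → a ≤ K → b ≤ K → h a ≡ h b → a ≡ b
        h-injective {zero}  {zero}  _         _         _ = refl
        h-injective {zero}  {suc l} _         (s≤s l≤L) e = ⊥-elim (P⇒≢v (inside p l≤L) (sym e))
        h-injective {suc k} {zero}  (s≤s k≤L) _         e = ⊥-elim (P⇒≢v (inside p k≤L) e)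
        h-injective {suc k} {suc l} (s≤s k≤L) (s≤s l≤L) e with <-cmp k l
        ... | tri< k<l _ _ = ⊥-elim (no-repetition (l , s≤s l≤L , k , k<l , e))
        ... | tri≈ _ k≡l _ = cong suc k≡l
        ... | tri> _ _ l<k = ⊥-elim (no-repetition (k , s≤s k≤L , l , l<k , sym e))

        h-∉B : ∀ {a} → a ≤ K → h a ∉ B
        h-∉B {zero}  _         = v∉B
        h-∉B {suc k} (s≤s k≤L) = P⇒∉B (inside p k≤L)

        h-adj : ∀ {a b} → CyclicSucc K a b → Adj G (h a) (h b)
        h-adj (next {zero} _)        = subst (Adj G v) (sym (at-0 p)) vx
        h-adj (next {suc k} (s≤s k<L)) = step p k<L
        h-adj wrap                   = Adj-sym (subst (Adj G v) (sym (at-len p)) vy)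

        v-neighbour-index : ∀ {k} → k ≤ L → Adj G v (at p k) →
          CyclicSucc K 0 (suc k) ⊎ CyclicSucc K (suc k) 0
        v-neighbour-index {zero}  _   _ = inj₁ (next (s≤s z≤n))
        v-neighbour-index {suc k} k<L e with m≤n⇒m<n∨m≡n k<L
        ... | inj₁ k+1<L = ⊥-elim (no-inner (suc k , k+1<L , s≤s z≤n , e))
        ... | inj₂ refl  = inj₂ wrap

        walk-adj-index : ∀ {k l} → k < l → l ≤ L → Adj G (at p k) (at p l) →
          CyclicSucc K (suc k) (suc l)
        walk-adj-index {k} {suc t} (s≤s k≤t) t<L e with m≤n⇒m<n∨m≡n k≤t
        ... | inj₁ k<t = ⊥-elim (no-chord (t , t<L , k , k<t , e))
        ... | inj₂ refl = next (s≤s t<L)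

        h-adj⇒cyclicSucc : ∀ {a b} → a ≤ K → b ≤ K → Adj G (h a) (h b) →
          CyclicSucc K a b ⊎ CyclicSucc K b a
        h-adj⇒cyclicSucc {zero}  {zero}  _         _         e = ⊥-elim (Adj-irrefl e)
        h-adj⇒cyclicSucc {zero}  {suc l} _         (s≤s l≤L) e = v-neighbour-index l≤L e
        h-adj⇒cyclicSucc {suc k} {zero}  (s≤s k≤L) _         e =
          swap (v-neighbour-index k≤L (Adj-sym e))
        h-adj⇒cyclicSucc {suc k} {suc l} (s≤s k≤L) (s≤s l≤L) e with <-cmp k l
        ... | tri< k<l _ _ = inj₁ (walk-adj-index k<l l≤L e)
        ... | tri≈ _ refl _ = ⊥-elim (Adj-irrefl e)
        ... | tri> _ _ l<k = inj₂ (walk-adj-index l<k k≤L (Adj-sym e))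

      module _ (chordal : ChordalMinus G B)
               (neighbours-independent : ∀ {x y} → P x → P y → Adj G v x → Adj G v y → ¬ Adj G x y)
               where

        induced-walk-between-neighbours : ∀ {x y L} (p : Walk x y L) → Adj G v x → Adj G v y →
          ¬ Repetition p → ¬ Chord p → ¬ InnerNeighbour v p → x ≡ y
        induced-walk-between-neighbours {L = zero} p _ _ _ _ _ = trans (sym (at-0 p)) (at-len p)
        induced-walk-between-neighbours {L = suc zero} p vx vy _ _ _ =
          ⊥-elim (neighbours-independent (subst P (at-0 p) (inside p z≤n))
                                         (subst P (at-len p) (inside p ≤-refl)) vx vy
                                         (subst₂ (Adj G) (at-0 p) (at-len p) (step p ≤-refl)))
        induced-walk-between-neighbours {L = suc (suc _)} p vx vy no-repetition no-chord no-inner =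
          ⊥-elim (chordal (chordless-cycle p vx vy no-repetition no-chord no-inner))

        NeighboursJoinedOnlyTrivially : ℕ → Set
        NeighboursJoinedOnlyTrivially L = ∀ {x y} → Walk x y L → Adj G v x → Adj G v y → x ≡ y

        walk-between-neighbours : ∀ L → NeighboursJoinedOnlyTrivially L
        walk-between-neighbours = <-rec _ shorten
          where
          shorten : ∀ L → (∀ {L′} → L′ < L → NeighboursJoinedOnlyTrivially L′) →
            NeighboursJoinedOnlyTrivially L
          shorten L rec p vx vy with innerNeighbour? v p
          ... | yes (k , k<L , 0<k , vk) =
            trans (rec k<L (take p k (<⇒≤ k<L)) vx vk)
                  (rec (∸-monoʳ-< {L} 0<k (<⇒≤ k<L)) (drop p k (<⇒≤ k<L)) vk vy)
          ... | no no-inner with repetition? p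
          ...   | yes r = let (_ , shorter , q) = shortcut-repetition p r in rec shorter q vx vy
          ...   | no no-repetition with chord? p
          ...     | yes c = let (_ , shorter , q) = shortcut-chord p c in rec shorter q vx vy
          ...     | no no-chord =
            induced-walk-between-neighbours p vx vy no-repetition no-chord no-inner

neighbour∈H⇒∈I : ∀ {n} (G : Graph n) {v B I u} → InH G v B I u → Adj G v u → u ∈ I
neighbour∈H⇒∈I G {I = I} {u} (_ , u∉B , u∉X) vu with u ∈? I
... | yes u∈I = u∈I
... | no u∉I  = ⊥-elim (u∉X (vu , u∉B , u∉I))

neighbour∈I⇒∈H : ∀ {n} (G : Graph n) {v B I u} → u ∈ I → Adj G v u → u ∉ B → InH G v B I u
neighbour∈I⇒∈H G {v} u∈I vu u∉B =
  (λ u≡v → Adj-irrefl G (subst (Adj G v) u≡v vu)) , u∉B , λ u∈X → proj₂ (proj₂ u∈X) u∈I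

lemma3p7 : ∀ {n} (G : Graph n) (EI EM : EdgeSet n) → EdgeSubset G EI → EdgeSubset G EM →
    (v : Fin n) (B : Subset n) → v ∉ B → ChordalMinus G B →
    (I : Subset n) → Independent G I → (∀ u → u ∈ I → NR G EI EM v u × u ∉ B) →
    (a : Fin n) → InH G v B I a → (∃ λ i → i ∈ I × ReachH G v B I a i) →
    ∃ λ i → i ∈ I × ReachH G v B I a i ×
      (∀ w → ReachH G v B I a w → N G v w → w ≡ i)
lemma3p7 G _ _ _ _ v B v∉B chordal I independent I⊆NR _ _ (i , i∈I , a⇝i) =
  i , i∈I , a⇝i , λ w a⇝w vw → sym (joined (reverse EdgeH-sym a⇝i ◅◅ a⇝w) vw)
  where
  open Walks G (InH G v B I)

  vi : Adj G v i
  vi = proj₁ (proj₁ (I⊆NR i i∈I))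

  EdgeH-sym : ∀ {x y} → EdgeH G v B I x y → EdgeH G v B I y x
  EdgeH-sym (x∈H , y∈H , xy) = y∈H , x∈H , Adj-sym G xy

  joined : ∀ {w} → ReachH G v B I i w → Adj G v w → i ≡ w
  joined i⇝w vw with walk-of-star (neighbour∈I⇒∈H G i∈I vi (proj₂ (I⊆NR i i∈I))) i⇝w
  ... | L , p =
    walk-between-neighbours v B v∉B proj₁ (λ u∈H → proj₁ (proj₂ u∈H)) chordal
      (λ x∈H y∈H vx vy → independent _ _ (neighbour∈H⇒∈I G x∈H vx) (neighbour∈H⇒∈I G y∈H vy))
      L p vi vw
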